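{- Let $f,g\in\mathbb{Z}[q]$ have non-negative coefficients. Suppose $f$ has no internal zeros and has at least two non-zero coefficients, and $g$ has no adjacent internal zeros. Then $fg$ has no internal zeros.
   Context: For $P(q)=\sum c_iq^i$: an internal zero is an index $j$ with $c_j=0$ but $c_i\neq0$ and $c_k\neq0$ for some $i<j<k$. $P$ has no internal zeros if it has no internal zero; $P$ has no adjacent internal zeros if there is no $j$ such that both $j$ and $j+1$ are internal zeros. -}

module Defs where

open import Data.Nat using (ℕ; zero; suc; _+_; _*_; _<_)
open import Data.List using (List; []; _∷_; map)
open import Data.Product using (∃-syntax; _×_)
open import Relation.Nullary using (¬_)
open import Relation.Binary.PropositionalEquality using (_≡_; _≢_)

-- A polynomial in ℤ[q] with non-negative coefficients is represented by its
-- list of coefficients (as natural numbers), lowest degree first: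
-- c₀ ∷ c₁ ∷ … ∷ cₙ ∷ []  represents  c₀ + c₁ q + … + cₙ qⁿ.
-- (Trailing zeros are allowed and are harmless: all notions below only use
-- the coefficient function.)
Poly : Set
Poly = List ℕ

coeff : Poly → ℕ → ℕ
coeff []       _       = 0
coeff (c ∷ cs) zero    = c
coeff (c ∷ cs) (suc i) = coeff cs i

_⊕_ : Poly → Poly → Poly
[]       ⊕ qs       = qs
(p ∷ ps) ⊕ []       = p ∷ ps
(p ∷ ps) ⊕ (q ∷ qs) = (p + q) ∷ (ps ⊕ qs)

_⊗_ : Poly → Poly → Poly
[]       ⊗ g = []
(a ∷ as) ⊗ g = map (a *_) g ⊕ (0 ∷ (as ⊗ g))

InternalZero : Poly → ℕ → Set
InternalZero P j =
  coeff P j ≡ 0 ×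
  (∃[ i ] (i < j × coeff P i ≢ 0)) ×
  (∃[ k ] (j < k × coeff P k ≢ 0))

NoInternalZeros : Poly → Set
NoInternalZeros P = ∀ j → ¬ InternalZero P j

NoAdjacentInternalZeros : Poly → Set
NoAdjacentInternalZeros P = ∀ j → ¬ (InternalZero P j × InternalZero P (suc j))

AtLeastTwoNonzero : Poly → Set
AtLeastTwoNonzero P = ∃[ i ] ∃[ k ] (i < k × coeff P i ≢ 0 × coeff P k ≢ 0)

module Submission where

-- Let n be an internal zero of fg: (fg)ₙ = 0 while (fg)ₘ ≠ 0
-- and (fg)ₖ ≠ 0 for some m < n < k.  Since all coefficients are
-- non-negative there is no cancellation, so (fg)ₙ ≠ 0 exactly when
-- n = i + j with fᵢ ≠ 0 and gⱼ ≠ 0.  Write m = i₁ + j₁ and k = i₂ + j₂ in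
-- this way.  As f has no internal zeros and at least two non-zero
-- coefficients, f is non-zero on a whole interval [lo , hi] with lo < hi,
-- lo ≤ i₁ and i₂ ≤ hi.  The support of g has no gap of length two, and it
-- is shifted by every amount in [lo , hi], a window of length ≥ 1; hence
-- the shifted copies j + [lo , hi] (gⱼ ≠ 0) cover everything from lo + j₁
-- to hi + j₂, in particular n, which contradicts (fg)ₙ = 0.

open import Defs
open import Data.Product using (_×_; _,_; ∃-syntax)
open import Data.Nat using (ℕ; zero; suc; _+_; _*_; _≤_; _<_; _⊓_; _⊔_; _≟_; _≤?_)
open import Data.Nat.Properties
open import Data.List using (_∷_; []; map)
open import Data.Sum using (_⊎_; inj₁; inj₂; [_,_]′)
open import Data.Empty using (⊥-elim)
open import Function using (_∘_)
open import Relation.Nullary using (yes; no)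
open import Relation.Binary.PropositionalEquality

coeff-⊕ : ∀ p q n → coeff (p ⊕ q) n ≡ coeff p n + coeff q n
coeff-⊕ []      q       n       = refl
coeff-⊕ (x ∷ p) []      n       = sym (+-identityʳ _)
coeff-⊕ (x ∷ p) (y ∷ q) zero    = refl
coeff-⊕ (x ∷ p) (y ∷ q) (suc n) = coeff-⊕ p q n

coeff-scale : ∀ a g n → coeff (map (a *_) g) n ≡ a * coeff g n
coeff-scale a []      n       = sym (*-zeroʳ a)
coeff-scale a (x ∷ g) zero    = refl
coeff-scale a (x ∷ g) (suc n) = coeff-scale a g n

coeff-⊗-cons : ∀ a as g n →
  coeff ((a ∷ as) ⊗ g) n ≡ a * coeff g n + coeff (0 ∷ (as ⊗ g)) n
coeff-⊗-cons a as g n = begin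
  coeff (map (a *_) g ⊕ (0 ∷ (as ⊗ g))) n          ≡⟨ coeff-⊕ (map (a *_) g) _ n ⟩
  coeff (map (a *_) g) n + coeff (0 ∷ (as ⊗ g)) n  ≡⟨ cong (_+ _) (coeff-scale a g n) ⟩
  a * coeff g n + coeff (0 ∷ (as ⊗ g)) n           ∎
  where open ≡-Reasoning

-- The support of a product of polynomials with non-negative coefficients
-- is the sumset of the supports: no cancellation can occur (first lemma),
-- and every non-zero coefficient comes from some product fᵢ gⱼ (second).

product-nonzero : ∀ f g i j → coeff f i ≢ 0 → coeff g j ≢ 0 →
  coeff (f ⊗ g) (i + j) ≢ 0
product-nonzero []       g i       j fᵢ≢0 gⱼ≢0 = λ _ → fᵢ≢0 refl
product-nonzero (a ∷ as) g zero    j a≢0  gⱼ≢0 =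
  [ a≢0 , gⱼ≢0 ]′ ∘ m*n≡0⇒m≡0∨n≡0 a ∘ m+n≡0⇒m≡0 _ ∘ trans (sym (coeff-⊗-cons a as g j))
product-nonzero (a ∷ as) g (suc i) j fᵢ≢0 gⱼ≢0 =
  product-nonzero as g i j fᵢ≢0 gⱼ≢0 ∘ m+n≡0⇒n≡0 _ ∘ trans (sym (coeff-⊗-cons a as g (suc (i + j))))

product-support : ∀ f g n → coeff (f ⊗ g) n ≢ 0 →
  ∃[ i ] ∃[ j ] (i + j ≡ n × coeff f i ≢ 0 × coeff g j ≢ 0)
product-support []       g n h = ⊥-elim (h refl)
product-support (a ∷ as) g n h with a * coeff g n ≟ 0
... | no agₙ≢0 =
  0 , n , refl , (λ a≡0 → agₙ≢0 (cong (_* coeff g n) a≡0))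
               , (λ gₙ≡0 → agₙ≢0 (trans (cong (a *_) gₙ≡0) (*-zeroʳ a)))
product-support (a ∷ as) g zero    h | yes ag₀≡0 =
  ⊥-elim (h (trans (coeff-⊗-cons a as g 0) (cong (_+ 0) ag₀≡0)))
product-support (a ∷ as) g (suc n) h | yes agₙ≡0
  with product-support as g n (λ tail≡0 → h (trans (coeff-⊗-cons a as g (suc n)) (cong₂ _+_ agₙ≡0 tail≡0)))
... | i , j , refl , fᵢ≢0 , gⱼ≢0 = suc i , j , refl , fᵢ≢0 , gⱼ≢0

nonzero-between : ∀ f → NoInternalZeros f → ∀ {u w x} →
  coeff f u ≢ 0 → coeff f w ≢ 0 → u ≤ x → x ≤ w → coeff f x ≢ 0
nonzero-between f noZeros {u} {w} {x} fᵤ≢0 f_w≢0 u≤x x≤w fₓ≡0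
  with m≤n⇒m<n∨m≡n u≤x | m≤n⇒m<n∨m≡n x≤w
... | inj₂ refl | _         = fᵤ≢0 fₓ≡0
... | inj₁ _    | inj₂ refl = f_w≢0 fₓ≡0
... | inj₁ u<x  | inj₁ x<w  = noZeros x (fₓ≡0 , (u , u<x , fᵤ≢0) , (w , x<w , f_w≢0))

adjacent-nonzero : ∀ g → NoAdjacentInternalZeros g → ∀ {j₁ j₂ x} →
  coeff g j₁ ≢ 0 → coeff g j₂ ≢ 0 → j₁ < x → suc x < j₂ →
  coeff g x ≢ 0 ⊎ coeff g (suc x) ≢ 0
adjacent-nonzero g noAdj {j₁} {j₂} {x} g₁≢0 g₂≢0 j₁<x sx<j₂
  with coeff g x ≟ 0 | coeff g (suc x) ≟ 0
... | no gₓ≢0 | _         = inj₁ gₓ≢0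
... | yes _   | no gₛₓ≢0  = inj₂ gₛₓ≢0
... | yes gₓ≡0 | yes gₛₓ≡0 = ⊥-elim (noAdj x
  ( (gₓ≡0 , (j₁ , j₁<x , g₁≢0) , (j₂ , <-trans (n<1+n x) sx<j₂ , g₂≢0))
  , (gₛₓ≡0 , (j₁ , <-trans j₁<x (n<1+n x) , g₁≢0) , (j₂ , sx<j₂ , g₂≢0))))

⊓-closed : ∀ (P : ℕ → Set) {a b} → P a → P b → P (a ⊓ b)
⊓-closed P {a} {b} pa pb with ⊓-sel a b
... | inj₁ eq = subst P (sym eq) pa
... | inj₂ eq = subst P (sym eq) pb

⊔-closed : ∀ (P : ℕ → Set) {a b} → P a → P b → P (a ⊔ b)
⊔-closed P {a} {b} pa pb with ⊔-sel a b
... | inj₁ eq = subst P (sym eq) pa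
... | inj₂ eq = subst P (sym eq) pb

Covers : Poly → ℕ → ℕ → ℕ → ℕ → Set
Covers g lo hi n j = coeff g j ≢ 0 × lo + j ≤ n × n ≤ hi + j

-- The gap case of the covering argument: if n = hi + x lies strictly
-- between the windows of j₁ and j₂, then x or x + 1 lies strictly between
-- j₁ and j₂, and whichever of them is in the support of g covers n.
gap-covered : ∀ g → NoAdjacentInternalZeros g → ∀ {lo hi j₁ j₂} x →
  coeff g j₁ ≢ 0 → coeff g j₂ ≢ 0 → lo < hi →
  hi + j₁ < hi + x → hi + x < lo + j₂ → ∃[ j ] Covers g lo hi (hi + x) j
gap-covered g noAdj {lo} {hi} {j₁} {j₂} x g₁≢0 g₂≢0 lo<hi left right =
  cover (adjacent-nonzero g noAdj g₁≢0 g₂≢0 j₁<x sx<j₂)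
  where
  j₁<x : j₁ < x
  j₁<x = +-cancelˡ-< hi j₁ x left
  -- the window of x + 1 still starts no later than hi + x, as lo < hi
  lo+sx≤n : lo + suc x ≤ hi + x
  lo+sx≤n = subst (_≤ hi + x) (sym (+-suc lo x)) (+-monoˡ-≤ x lo<hi)
  sx<j₂ : suc x < j₂
  sx<j₂ = +-cancelˡ-< lo (suc x) j₂ (≤-<-trans lo+sx≤n right)
  cover : coeff g x ≢ 0 ⊎ coeff g (suc x) ≢ 0 → ∃[ j ] Covers g lo hi (hi + x) j
  cover (inj₁ gₓ≢0)  = x , gₓ≢0 , +-monoˡ-≤ x (<⇒≤ lo<hi) , ≤-refl
  cover (inj₂ gₛₓ≢0) = suc x , gₛₓ≢0 , lo+sx≤n , +-monoʳ-≤ hi (n≤1+n x)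

windows-cover : ∀ g → NoAdjacentInternalZeros g → ∀ {lo hi j₁ j₂ n} →
  coeff g j₁ ≢ 0 → coeff g j₂ ≢ 0 → lo < hi →
  lo + j₁ ≤ n → n ≤ hi + j₂ → ∃[ j ] Covers g lo hi n j
windows-cover g noAdj {lo} {hi} {j₁} {j₂} {n} g₁≢0 g₂≢0 lo<hi from to
  with n ≤? hi + j₁ | lo + j₂ ≤? n
... | yes n≤hi+j₁ | _          = j₁ , g₁≢0 , from , n≤hi+j₁
... | no _        | yes lo+j₂≤n = j₂ , g₂≢0 , lo+j₂≤n , to
... | no n≰hi+j₁  | no lo+j₂≰n
  with m≤n⇒∃[o]m+o≡n (≤-trans (m≤m+n hi j₁) (<⇒≤ (≰⇒> n≰hi+j₁)))
...   | x , refl = gap-covered g noAdj x g₁≢0 g₂≢0 lo<hi (≰⇒> n≰hi+j₁) (≰⇒> lo+j₂≰n)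

window-split : ∀ {lo hi j n} → lo + j ≤ n → n ≤ hi + j →
  ∃[ i ] (i + j ≡ n × lo ≤ i × i ≤ hi)
window-split {lo} {hi} {j} {n} from to with m≤n⇒∃[o]m+o≡n (≤-trans (m≤n+m j lo) from)
... | i , refl =
  i , +-comm i j , +-cancelʳ-≤ j lo i (subst (lo + j ≤_) (+-comm j i) from)
                 , +-cancelʳ-≤ j i hi (subst (_≤ hi + j) (+-comm j i) to)

nonzero-interval : ∀ f → NoInternalZeros f → AtLeastTwoNonzero f → ∀ {i₁ i₂} →
  coeff f i₁ ≢ 0 → coeff f i₂ ≢ 0 →
  ∃[ lo ] ∃[ hi ] (lo < hi × lo ≤ i₁ × i₂ ≤ hi × (∀ {x} → lo ≤ x → x ≤ hi → coeff f x ≢ 0))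
nonzero-interval f noZeros (p , q , p<q , fₚ≢0 , f_q≢0) {i₁} {i₂} f₁≢0 f₂≢0 =
  p ⊓ i₁ , q ⊔ i₂ , ≤-<-trans (m⊓n≤m p i₁) (<-≤-trans p<q (m≤m⊔n q i₂))
         , m⊓n≤n p i₁ , m≤n⊔m q i₂
         , nonzero-between f noZeros (⊓-closed Nonzero fₚ≢0 f₁≢0) (⊔-closed Nonzero f_q≢0 f₂≢0)
  where
  Nonzero : ℕ → Set
  Nonzero x = coeff f x ≢ 0

lemma6p1 : (f g : Poly) →
    NoInternalZeros f → AtLeastTwoNonzero f →
    NoAdjacentInternalZeros g →
    NoInternalZeros (f ⊗ g)
lemma6p1 f g noZeros twoNonzero noAdj n (fgₙ≡0 , (m , m<n , fgₘ≢0) , (k , n<k , fgₖ≢0))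
  with product-support f g m fgₘ≢0 | product-support f g k fgₖ≢0
... | i₁ , j₁ , refl , f₁≢0 , g₁≢0 | i₂ , j₂ , refl , f₂≢0 , g₂≢0
  with nonzero-interval f noZeros twoNonzero f₁≢0 f₂≢0
... | lo , hi , lo<hi , lo≤i₁ , i₂≤hi , nonzero-on
  with windows-cover g noAdj g₁≢0 g₂≢0 lo<hi
         (≤-trans (+-monoˡ-≤ j₁ lo≤i₁) (<⇒≤ m<n)) (≤-trans (<⇒≤ n<k) (+-monoˡ-≤ j₂ i₂≤hi))
... | j , gⱼ≢0 , lo+j≤n , n≤hi+j with window-split {j = j} lo+j≤n n≤hi+j
... | i , refl , lo≤i , i≤hi = product-nonzero f g i j (nonzero-on lo≤i i≤hi) gⱼ≢0 fgₙ≡0
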